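{- For every loop-RKA term $t$ and every structure $\mathfrak A$, the relation denoted by $t$ in $\mathfrak A$ equals the relation recognized by the loop-automaton $\mathcal A_t$ on $\mathfrak A$.
   Context: Loop-RKA terms $t ::= a \mid 0 \mid I \mid t+t \mid t;t \mid t^* \mid t^{\circlearrowleft}$ are interpreted as binary relations $t^{\mathfrak A}$ on a structure $\mathfrak A$ ($t^{\circlearrowleft}$ as $t^{\mathfrak A}\cap$ identity). A loop-automaton has finite state set $Q$, source and target states, and transitions labeled by variables $a$, by $I$ (epsilon), or by $\ell_{(p',q')}$ for $p',q'\in Q$ (allowed at vertex $x$ only if there is a run from $p'$ to $q'$ that starts and ends at $x$). The relation recognized on $\mathfrak A$ is the set of pairs $(x,y)$ such that some run from the source state at $x$ reaches the target state at $y$. $\mathcal A_t$ is the Thompson-style construction extended by: $\mathcal A_{t^{\circlearrowleft}}$ consists of a single $\ell_{(p',q')}$-transition from source to target, together with a disjoint copy of $\mathcal A_t$ with source $p'$ and target $q'$ (fresh). -}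

module Defs where

open import Data.Nat using (ℕ; _+_)
open import Data.Fin using (Fin; zero; suc; _↑ˡ_; _↑ʳ_)
open import Data.List using (List; []; _∷_; _++_; map)
open import Data.List.Membership.Propositional using (_∈_)
open import Data.Product using (_×_; _,_; ∃)
open import Data.Sum using (_⊎_)
open import Data.Empty using (⊥)
open import Relation.Binary.PropositionalEquality using (_≡_)
open import Relation.Binary.Construct.Closure.ReflexiveTransitive using (Star)

data Term (V : Set) : Set where
  var  : V → Term V
  𝟘    : Term V
  𝟙    : Term V
  _⊕_  : Term V → Term V → Term V
  _⨾_  : Term V → Term V → Term V
  _⋆   : Term V → Term V
  _↺   : Term V → Term V

record Structure (V : Set) : Set₁ where
  field
    D : Set
    R : V → D → D → Set

open Structure public

⟦_⟧ : ∀ {V} → Term V → (𝔄 : Structure V) → D 𝔄 → D 𝔄 → Set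
⟦ var a ⟧ 𝔄 x y = R 𝔄 a x y
⟦ 𝟘 ⟧ 𝔄 x y = ⊥
⟦ 𝟙 ⟧ 𝔄 x y = x ≡ y
⟦ t ⊕ u ⟧ 𝔄 x y = ⟦ t ⟧ 𝔄 x y ⊎ ⟦ u ⟧ 𝔄 x y
⟦ t ⨾ u ⟧ 𝔄 x y = ∃ λ z → ⟦ t ⟧ 𝔄 x z × ⟦ u ⟧ 𝔄 z y
⟦ t ⋆ ⟧ 𝔄 x y = Star (⟦ t ⟧ 𝔄) x y
⟦ t ↺ ⟧ 𝔄 x y = ⟦ t ⟧ 𝔄 x y × x ≡ y

data Label (V : Set) (n : ℕ) : Set where
  lvar  : V → Label V n
  leps  : Label V n
  lloop : Fin n → Fin n → Label V n

record LoopAut (V : Set) : Set where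
  field
    n     : ℕ
    src   : Fin n
    tgt   : Fin n
    trans : List (Fin n × Label V n × Fin n)

open LoopAut public

data Run {V : Set} (A : LoopAut V) (𝔄 : Structure V)
         : Fin (n A) → D 𝔄 → Fin (n A) → D 𝔄 → Set where
  done  : ∀ {p x} → Run A 𝔄 p x p x
  stepV : ∀ {p p' q a x x' y} → (p , lvar a , p') ∈ trans A → R 𝔄 a x x' →
          Run A 𝔄 p' x' q y → Run A 𝔄 p x q y
  stepI : ∀ {p p' q x y} → (p , leps , p') ∈ trans A →
          Run A 𝔄 p' x q y → Run A 𝔄 p x q y
  stepL : ∀ {p p' q p₁ q₁ x y} → (p , lloop p₁ q₁ , p') ∈ trans A →
          Run A 𝔄 p₁ x q₁ x →
          Run A 𝔄 p' x q y → Run A 𝔄 p x q y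

Recognized : ∀ {V} → LoopAut V → (𝔄 : Structure V) → D 𝔄 → D 𝔄 → Set
Recognized A 𝔄 x y = Run A 𝔄 (src A) x (tgt A) y

mapLabel : ∀ {V m k} → (Fin m → Fin k) → Label V m → Label V k
mapLabel f (lvar a) = lvar a
mapLabel f leps = leps
mapLabel f (lloop p q) = lloop (f p) (f q)

mapTrans : ∀ {V m k} → (Fin m → Fin k) →
           List (Fin m × Label V m × Fin m) → List (Fin k × Label V k × Fin k)
mapTrans f = map (λ { (p , l , q) → (f p , mapLabel f l , f q) })

-- states 0 and 1 are fresh; the old states are shifted by 2
sh : ∀ {m} → Fin m → Fin (2 + m)
sh i = suc (suc i)

s₀ s₁ : ∀ {m} → Fin (2 + m)
s₀ = zero
s₁ = suc zero

aut : ∀ {V} → Term V → LoopAut V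
aut (var a) = record { n = 2 ; src = s₀ ; tgt = s₁ ; trans = (s₀ , lvar a , s₁) ∷ [] }
aut 𝟘       = record { n = 2 ; src = s₀ ; tgt = s₁ ; trans = [] }
aut 𝟙       = record { n = 2 ; src = s₀ ; tgt = s₁ ; trans = (s₀ , leps , s₁) ∷ [] }
aut (t ⊕ u) =
  let At = aut t ; Au = aut u
      ι₁ : Fin (n At) → Fin (2 + (n At + n Au))
      ι₁ i = sh (i ↑ˡ n Au)
      ι₂ : Fin (n Au) → Fin (2 + (n At + n Au))
      ι₂ j = sh (n At ↑ʳ j)
  in record
    { n = 2 + (n At + n Au) ; src = s₀ ; tgt = s₁
    ; trans = (s₀ , leps , ι₁ (src At)) ∷ (s₀ , leps , ι₂ (src Au))
            ∷ (ι₁ (tgt At) , leps , s₁) ∷ (ι₂ (tgt Au) , leps , s₁)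
            ∷ (mapTrans ι₁ (trans At) ++ mapTrans ι₂ (trans Au)) }
aut (t ⨾ u) =
  let At = aut t ; Au = aut u
      ι₁ : Fin (n At) → Fin (n At + n Au)
      ι₁ i = i ↑ˡ n Au
      ι₂ : Fin (n Au) → Fin (n At + n Au)
      ι₂ j = n At ↑ʳ j
  in record
    { n = n At + n Au ; src = ι₁ (src At) ; tgt = ι₂ (tgt Au)
    ; trans = (ι₁ (tgt At) , leps , ι₂ (src Au))
            ∷ (mapTrans ι₁ (trans At) ++ mapTrans ι₂ (trans Au)) }
aut (t ⋆) =
  let At = aut t in record
    { n = 2 + n At ; src = s₀ ; tgt = s₁
    ; trans = (s₀ , leps , sh (src At)) ∷ (s₀ , leps , s₁)
            ∷ (sh (tgt At) , leps , sh (src At)) ∷ (sh (tgt At) , leps , s₁)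
            ∷ mapTrans sh (trans At) }
aut (t ↺) =
  let At = aut t in record
    { n = 2 + n At ; src = s₀ ; tgt = s₁
    ; trans = (s₀ , lloop (sh (src At)) (sh (tgt At)) , s₁)
            ∷ mapTrans sh (trans At) }

-- Runs of the Thompson-style automaton aut t are analysed through the copies of the
-- sub-automata it contains. A run that enters a copy either stays in it or leaves it
-- only from the copy's target, along an ε-transition added by the construction, so it
-- restricts to a run of the sub-automaton followed by a remainder. The loop subruns
-- demanded by ℓ-transitions of a copy also stay inside it: their start states lie in
-- the disjoint copies built for t↺, from which the target of the whole automaton is
-- unreachable. Induction on t then gives both inclusions; for t* the run is cut into
-- iterations by well-founded induction on its length.

module Submission where

open import Defs
open import Relation.Binary.Core using (_⇔_; _⇒_)
open import Data.Nat using (ℕ; suc; _<_)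
open import Data.Nat.Properties using (m<n⇒m<1+n; n<1+n)
open import Data.Nat.Induction using (<-wellFounded)
open import Induction.WellFounded using (Acc; acc)
open import Data.Fin using (Fin; zero; suc; _↑ˡ_; _↑ʳ_)
open import Data.Fin.Properties using (↑ˡ-injective; ↑ʳ-injective; suc-injective)
open import Data.List using (List; _++_)
open import Data.List.Relation.Unary.Any using (here; there)
open import Data.List.Membership.Propositional using (_∈_; _∉_)
open import Data.List.Membership.Propositional.Properties using (∈-map⁻; ∈-map⁺; ∈-++⁻; ∈-++⁺ˡ; ∈-++⁺ʳ)
open import Data.Product using (_×_; _,_; ∃; proj₁; proj₂)
open import Data.Product.Properties using (,-injective)
open import Data.Sum using (_⊎_; inj₁; inj₂)
open import Data.Empty using (⊥; ⊥-elim)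
open import Function.Definitions using (Injective)
open import Relation.Nullary using (¬_)
open import Relation.Binary.PropositionalEquality using (_≡_; _≢_; refl; sym)
open import Relation.Binary.Construct.Closure.ReflexiveTransitive using (Star; ε; _◅_)

module _ {V : Set} {A : LoopAut V} {𝔄 : Structure V} where

  length : ∀ {p x q y} → Run A 𝔄 p x q y → ℕ
  length done          = 0
  length (stepV _ _ ρ) = suc (length ρ)
  length (stepI _ ρ)   = suc (length ρ)
  length (stepL _ _ ρ) = suc (length ρ)

  infixr 5 _++ᴿ_
  _++ᴿ_ : ∀ {p x q y r z} → Run A 𝔄 p x q y → Run A 𝔄 q y r z → Run A 𝔄 p x r z
  done          ++ᴿ τ = τ
  stepV e h ρ   ++ᴿ τ = stepV e h (ρ ++ᴿ τ)
  stepI e ρ     ++ᴿ τ = stepI e (ρ ++ᴿ τ)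
  stepL e σ ρ   ++ᴿ τ = stepL e σ (ρ ++ᴿ τ)

  run-from-sink : ∀ {q x y} → (∀ {l r} → (q , l , r) ∉ trans A) → Run A 𝔄 q x q y → x ≡ y
  run-from-sink sink done          = refl
  run-from-sink sink (stepV e _ _) = ⊥-elim (sink e)
  run-from-sink sink (stepI e _)   = ⊥-elim (sink e)
  run-from-sink sink (stepL e _ _) = ⊥-elim (sink e)

  first-ε-step : ∀ {p q x y} {P : Fin (n A) → Set} →
                 (∀ {l r} → (p , l , r) ∈ trans A → l ≡ leps × P r) → p ≢ q →
                 Run A 𝔄 p x q y → ∃ λ r → P r × Run A 𝔄 r x q y
  first-ε-step only p≢q done = ⊥-elim (p≢q refl)
  first-ε-step only _ (stepV e _ _) with only e
  ... | () , _
  first-ε-step only _ (stepI e ρ) = _ , proj₂ (only e) , ρ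
  first-ε-step only _ (stepL e _ _) with only e
  ... | () , _

LoopSource : ∀ {V m} → List (Fin m × Label V m × Fin m) → Fin m → Set
LoopSource xs a = ∃ λ b → ∃ λ p → ∃ λ q → (p , lloop a b , q) ∈ xs

module _ {V : Set} {m k : ℕ} (f : Fin m → Fin k) {xs : List (Fin m × Label V m × Fin m)} where

  mapTrans-source : ∀ {p l q} → (p , l , q) ∈ mapTrans f xs → ∃ λ i → f i ≡ p
  mapTrans-source e with ∈-map⁻ _ e
  ... | (i , _ , _) , _ , refl = i , refl

  mapTrans-loop-source : ∀ {p a b q} → (p , lloop a b , q) ∈ mapTrans f xs →
                         ∃ λ a′ → a ≡ f a′ × LoopSource xs a′
  mapTrans-loop-source e with ∈-map⁻ _ e
  ... | (p , lloop a′ b′ , q) , e′ , refl = a′ , refl , b′ , p , q , e′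
  ... | (_ , lvar _ , _) , _ , ()
  ... | (_ , leps , _) , _ , ()

  mapTrans-outside : ∀ {p l q} → (∀ i → f i ≢ p) → (p , l , q) ∉ mapTrans f xs
  mapTrans-outside outside e with mapTrans-source e
  ... | i , eq = outside i eq

data Reflected {V : Set} (A : LoopAut V) {k : ℕ} (ι : Fin (n A) → Fin k) (Exit : Fin k → Set)
     : Fin (n A) → Label V k → Fin k → Set where
  var  : ∀ {p a q} → (p , lvar a , q) ∈ trans A → Reflected A ι Exit p (lvar a) (ι q)
  eps  : ∀ {p q} → (p , leps , q) ∈ trans A → Reflected A ι Exit p leps (ι q)
  loop : ∀ {p p₁ q₁ q} → (p , lloop p₁ q₁ , q) ∈ trans A →
         Reflected A ι Exit p (lloop (ι p₁) (ι q₁)) (ι q)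
  exit : ∀ {r} → Exit r → Reflected A ι Exit (tgt A) leps r

module _ {V : Set} {A : LoopAut V} {k : ℕ} {ι : Fin (n A) → Fin k} {Exit : Fin k → Set}
         (ι-injective : Injective _≡_ _≡_ ι) where

  reflect-exit : ∀ {p l r s} → (ι p , l , r) ≡ (ι (tgt A) , leps , s) → Exit s →
                 Reflected A ι Exit p l r
  reflect-exit eq x with ,-injective eq
  ... | p≡ , lr≡ with ι-injective p≡ | ,-injective lr≡
  ... | refl | refl , refl = exit x

  reflect-mapped : ∀ {p l r} → (ι p , l , r) ∈ mapTrans ι (trans A) → Reflected A ι Exit p l r
  reflect-mapped e with ∈-map⁻ _ e
  ... | (_ , l′ , _) , e′ , eq with ,-injective eq
  ... | p≡ , lr≡ with ι-injective p≡ | ,-injective lr≡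
  ... | refl | refl , refl = reflect l′ e′
    where
    reflect : ∀ {p q} (l : Label V (n A)) → (p , l , q) ∈ trans A →
              Reflected A ι Exit p (mapLabel ι l) (ι q)
    reflect (lvar _)    = var
    reflect leps        = eps
    reflect (lloop _ _) = loop

  module _ {m′ : ℕ} {κ : Fin m′ → Fin k} {ys : List (Fin m′ × Label V m′ × Fin m′)}
           (ι≢κ : ∀ {i j} → ι i ≢ κ j) where

    reflect-++ˡ : ∀ {p l r} → (ι p , l , r) ∈ mapTrans ι (trans A) ++ mapTrans κ ys →
                  Reflected A ι Exit p l r
    reflect-++ˡ e with ∈-++⁻ _ e
    ... | inj₁ e₁ = reflect-mapped e₁
    ... | inj₂ e₂ = ⊥-elim (mapTrans-outside κ (λ _ eq → ι≢κ (sym eq)) e₂)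

    reflect-++ʳ : ∀ {p l r} → (ι p , l , r) ∈ mapTrans κ ys ++ mapTrans ι (trans A) →
                  Reflected A ι Exit p l r
    reflect-++ʳ e with ∈-++⁻ (mapTrans κ ys) e
    ... | inj₁ e₁ = ⊥-elim (mapTrans-outside κ (λ _ eq → ι≢κ (sym eq)) e₁)
    ... | inj₂ e₂ = reflect-mapped e₂

-- A copy of A inside B that B can only leave from the target of A, by an ε-transition into Exit.
record Component {V : Set} (A B : LoopAut V) : Set₁ where
  field
    ι           : Fin (n A) → Fin (n B)
    ι-injective : Injective _≡_ _≡_ ι
    Exit        : Fin (n B) → Set
    embeds      : ∀ {p l q} → (p , l , q) ∈ trans A → (ι p , mapLabel ι l , ι q) ∈ trans B
    reflects    : ∀ {p l r} → (ι p , l , r) ∈ trans B → Reflected A ι Exit p l r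

LoopsAvoidTarget : ∀ {V} → LoopAut V → Set₁
LoopsAvoidTarget {V} A =
  ∀ {𝔄 : Structure V} {a x z} → LoopSource (trans A) a → ¬ Run A 𝔄 a x (tgt A) z

module _ {V : Set} {A B : LoopAut V} (c : Component A B) {𝔄 : Structure V} where
  open Component c

  embed : ∀ {p x q y} → Run A 𝔄 p x q y → Run B 𝔄 (ι p) x (ι q) y
  embed done          = done
  embed (stepV e h ρ) = stepV (embeds e) h (embed ρ)
  embed (stepI e ρ)   = stepI (embeds e) (embed ρ)
  embed (stepL e σ ρ) = stepL (embeds e) (embed σ) (embed ρ)

  data Restriction (p : Fin (n A)) (x : D 𝔄) (r : Fin (n B)) (y : D 𝔄) (k : ℕ) : Set where
    inside : ∀ {q} → r ≡ ι q → Run A 𝔄 p x q y → Restriction p x r y k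
    exits  : ∀ {z s} → Run A 𝔄 p x (tgt A) z → Exit s →
             (rest : Run B 𝔄 s z r y) → length rest < k → Restriction p x r y k

  private
    prepend : ∀ {p x p′ x′ r y k} → (∀ {q z} → Run A 𝔄 p′ x′ q z → Run A 𝔄 p x q z) →
              Restriction p′ x′ r y k → Restriction p x r y (suc k)
    prepend step (inside eq ρ)            = inside eq (step ρ)
    prepend step (exits ρ s rest shorter) = exits (step ρ) s rest (m<n⇒m<1+n shorter)

  restrict : LoopsAvoidTarget A → ∀ {p x r y} (ρ : Run B 𝔄 (ι p) x r y) →
             Restriction p x r y (length ρ)
  restrict sealed done = inside refl done
  restrict sealed (stepV e h ρ) with reflects e
  ... | var e′ = prepend (stepV e′ h) (restrict sealed ρ)
  restrict sealed (stepI e ρ) with reflects e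
  ... | eps e′ = prepend (stepI e′) (restrict sealed ρ)
  ... | exit s = exits done s ρ (n<1+n _)
  restrict sealed (stepL e σ ρ) with reflects e
  ... | loop e′ with restrict sealed σ
  ...   | exits σ′ _ _ _ = ⊥-elim (sealed (_ , _ , _ , e′) σ′)
  ...   | inside q₁≡ σ′ with ι-injective q₁≡
  ...     | refl = prepend (stepL e′ σ′) (restrict sealed ρ)

component-loops-avoid-target :
  ∀ {V} {A B : LoopAut V} (c : Component A B) → LoopsAvoidTarget A →
  (∀ {q} → tgt B ≡ Component.ι c q → q ≡ tgt A) →
  ∀ {𝔄 : Structure V} {a x z} → LoopSource (trans A) a → ¬ Run B 𝔄 (Component.ι c a) x (tgt B) z
component-loops-avoid-target c sealed target-inside src ρ with restrict c sealed ρ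
... | exits ρ′ _ _ _ = sealed src ρ′
... | inside eq ρ′ with target-inside eq
...   | refl = sealed src ρ′

sh-injective : ∀ {m} → Injective _≡_ _≡_ (sh {m})
sh-injective eq = suc-injective (suc-injective eq)

↑ˡ≢↑ʳ : ∀ {m k} (i : Fin m) (j : Fin k) → i ↑ˡ k ≢ m ↑ʳ j
↑ˡ≢↑ʳ zero    j ()
↑ˡ≢↑ʳ (suc i) j eq = ↑ˡ≢↑ʳ i j (suc-injective eq)

module _ {V : Set} (t u : Term V) where
  private
    ιˡ : Fin (n (aut t)) → Fin (n (aut (t ⊕ u)))
    ιˡ i = sh (i ↑ˡ n (aut u))
    ιʳ : Fin (n (aut u)) → Fin (n (aut (t ⊕ u)))
    ιʳ j = sh (n (aut t) ↑ʳ j)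

    ιˡ-injective : Injective _≡_ _≡_ ιˡ
    ιˡ-injective eq = ↑ˡ-injective _ _ _ (sh-injective eq)
    ιʳ-injective : Injective _≡_ _≡_ ιʳ
    ιʳ-injective eq = ↑ʳ-injective _ _ _ (sh-injective eq)
    ιˡ≢ιʳ : ∀ {i j} → ιˡ i ≢ ιʳ j
    ιˡ≢ιʳ eq = ↑ˡ≢↑ʳ _ _ (sh-injective eq)

  ⊕-copies-source : ∀ {p l r} →
    (p , l , r) ∈ mapTrans ιˡ (trans (aut t)) ++ mapTrans ιʳ (trans (aut u)) → ∃ λ i → sh i ≡ p
  ⊕-copies-source e with ∈-++⁻ (mapTrans ιˡ (trans (aut t))) e
  ... | inj₁ e₁ = _ , proj₂ (mapTrans-source ιˡ e₁)
  ... | inj₂ e₂ = _ , proj₂ (mapTrans-source ιʳ e₂)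

  ⊕-initial : ∀ {l r} → (s₀ , l , r) ∈ trans (aut (t ⊕ u)) →
              l ≡ leps × (r ≡ ιˡ (src (aut t)) ⊎ r ≡ ιʳ (src (aut u)))
  ⊕-initial (here refl)                        = refl , inj₁ refl
  ⊕-initial (there (here refl))                = refl , inj₂ refl
  ⊕-initial (there (there (here ())))
  ⊕-initial (there (there (there (here ()))))
  ⊕-initial (there (there (there (there e)))) with ⊕-copies-source e
  ... | _ , ()

  ⊕-left : Component (aut t) (aut (t ⊕ u))
  ⊕-left = record
    { ι = ιˡ ; ι-injective = ιˡ-injective ; Exit = _≡ s₁
    ; embeds = λ e → there (there (there (there (∈-++⁺ˡ (∈-map⁺ _ e)))))
    ; reflects = reflects }
    where
    reflects : ∀ {p l r} → (ιˡ p , l , r) ∈ trans (aut (t ⊕ u)) → Reflected (aut t) ιˡ (_≡ s₁) p l r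
    reflects (here ())
    reflects (there (here ()))
    reflects (there (there (here eq)))         = reflect-exit ιˡ-injective eq refl
    reflects (there (there (there (here eq)))) = ⊥-elim (ιˡ≢ιʳ (proj₁ (,-injective eq)))
    reflects (there (there (there (there e)))) = reflect-++ˡ ιˡ-injective ιˡ≢ιʳ e

  ⊕-right : Component (aut u) (aut (t ⊕ u))
  ⊕-right = record
    { ι = ιʳ ; ι-injective = ιʳ-injective ; Exit = _≡ s₁
    ; embeds = λ e → there (there (there (there (∈-++⁺ʳ _ (∈-map⁺ _ e)))))
    ; reflects = reflects }
    where
    reflects : ∀ {p l r} → (ιʳ p , l , r) ∈ trans (aut (t ⊕ u)) → Reflected (aut u) ιʳ (_≡ s₁) p l r
    reflects (here ())
    reflects (there (here ()))
    reflects (there (there (here eq)))         = ⊥-elim (ιˡ≢ιʳ (sym (proj₁ (,-injective eq))))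
    reflects (there (there (there (here eq)))) = reflect-exit ιʳ-injective eq refl
    reflects (there (there (there (there e)))) = reflect-++ʳ ιʳ-injective (λ eq → ιˡ≢ιʳ (sym eq)) e

module _ {V : Set} (t u : Term V) where
  private
    ιˡ : Fin (n (aut t)) → Fin (n (aut (t ⨾ u)))
    ιˡ i = i ↑ˡ n (aut u)
    ιʳ : Fin (n (aut u)) → Fin (n (aut (t ⨾ u)))
    ιʳ j = n (aut t) ↑ʳ j

    ⨾-left-injective : Injective _≡_ _≡_ ιˡ
    ⨾-left-injective = ↑ˡ-injective _ _ _

    ⨾-right-injective : Injective _≡_ _≡_ ιʳ
    ⨾-right-injective = ↑ʳ-injective _ _ _

  ⨾-left≢right : ∀ {i j} → ιˡ i ≢ ιʳ j
  ⨾-left≢right = ↑ˡ≢↑ʳ _ _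

  ⨾-left : Component (aut t) (aut (t ⨾ u))
  ⨾-left = record
    { ι = ιˡ ; ι-injective = ⨾-left-injective ; Exit = _≡ ιʳ (src (aut u))
    ; embeds = λ e → there (∈-++⁺ˡ (∈-map⁺ _ e))
    ; reflects = reflects }
    where
    reflects : ∀ {p l r} → (ιˡ p , l , r) ∈ trans (aut (t ⨾ u)) →
               Reflected (aut t) ιˡ (_≡ ιʳ (src (aut u))) p l r
    reflects (here eq) = reflect-exit ⨾-left-injective eq refl
    reflects (there e) = reflect-++ˡ ⨾-left-injective ⨾-left≢right e

  ⨾-right : Component (aut u) (aut (t ⨾ u))
  ⨾-right = record
    { ι = ιʳ ; ι-injective = ⨾-right-injective ; Exit = λ _ → ⊥
    ; embeds = λ e → there (∈-++⁺ʳ _ (∈-map⁺ _ e))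
    ; reflects = reflects }
    where
    reflects : ∀ {p l r} → (ιʳ p , l , r) ∈ trans (aut (t ⨾ u)) → Reflected (aut u) ιʳ (λ _ → ⊥) p l r
    reflects (here eq) = ⊥-elim (⨾-left≢right (sym (proj₁ (,-injective eq))))
    reflects (there e) = reflect-++ʳ ⨾-right-injective (λ eq → ⨾-left≢right (sym eq)) e

module _ {V : Set} (t : Term V) where

  ⋆-initial : ∀ {l r} → (s₀ , l , r) ∈ trans (aut (t ⋆)) →
              l ≡ leps × (r ≡ sh (src (aut t)) ⊎ r ≡ s₁)
  ⋆-initial (here refl)                        = refl , inj₁ refl
  ⋆-initial (there (here refl))                = refl , inj₂ refl
  ⋆-initial (there (there (here ())))
  ⋆-initial (there (there (there (here ()))))
  ⋆-initial (there (there (there (there e)))) with mapTrans-source sh e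
  ... | _ , ()

  ⋆-body : Component (aut t) (aut (t ⋆))
  ⋆-body = record
    { ι = sh ; ι-injective = sh-injective ; Exit = Exit
    ; embeds = λ e → there (there (there (there (∈-map⁺ _ e))))
    ; reflects = reflects }
    where
    Exit : Fin (n (aut (t ⋆))) → Set
    Exit r = r ≡ sh (src (aut t)) ⊎ r ≡ s₁
    reflects : ∀ {p l r} → (sh p , l , r) ∈ trans (aut (t ⋆)) → Reflected (aut t) sh Exit p l r
    reflects (here ())
    reflects (there (here ()))
    reflects (there (there (here eq)))         = reflect-exit sh-injective eq (inj₁ refl)
    reflects (there (there (there (here eq)))) = reflect-exit sh-injective eq (inj₂ refl)
    reflects (there (there (there (there e)))) = reflect-mapped sh-injective e

  ↺-initial : ∀ {l r} → (s₀ , l , r) ∈ trans (aut (t ↺)) →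
              l ≡ lloop (sh (src (aut t))) (sh (tgt (aut t))) × r ≡ s₁
  ↺-initial (here refl) = refl , refl
  ↺-initial (there e) with mapTrans-source sh e
  ... | _ , ()

  ↺-body : Component (aut t) (aut (t ↺))
  ↺-body = record
    { ι = sh ; ι-injective = sh-injective ; Exit = λ _ → ⊥
    ; embeds = λ e → there (∈-map⁺ _ e)
    ; reflects = reflects }
    where
    reflects : ∀ {p l r} → (sh p , l , r) ∈ trans (aut (t ↺)) → Reflected (aut t) sh (λ _ → ⊥) p l r
    reflects (here ())
    reflects (there e) = reflect-mapped sh-injective e

module _ {V : Set} where

  target-is-sink : (t : Term V) → ∀ {l r} → (tgt (aut t) , l , r) ∉ trans (aut t)
  target-is-sink (var a) (here ())
  target-is-sink (var a) (there ())
  target-is-sink 𝟘 ()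
  target-is-sink 𝟙 (here ())
  target-is-sink 𝟙 (there ())
  target-is-sink (t ⊕ u) (here ())
  target-is-sink (t ⊕ u) (there (here ()))
  target-is-sink (t ⊕ u) (there (there (here ())))
  target-is-sink (t ⊕ u) (there (there (there (here ()))))
  target-is-sink (t ⊕ u) (there (there (there (there e)))) with ⊕-copies-source t u e
  ... | _ , ()
  target-is-sink (t ⨾ u) e with Component.reflects (⨾-right t u) e
  ... | var e′ = target-is-sink u e′
  ... | eps e′ = target-is-sink u e′
  ... | loop e′ = target-is-sink u e′
  ... | exit ()
  target-is-sink (t ⋆) (here ())
  target-is-sink (t ⋆) (there (here ()))
  target-is-sink (t ⋆) (there (there (here ())))
  target-is-sink (t ⋆) (there (there (there (here ()))))
  target-is-sink (t ⋆) (there (there (there (there e)))) with mapTrans-source sh e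
  ... | _ , ()
  target-is-sink (t ↺) (here ())
  target-is-sink (t ↺) (there e) with mapTrans-source sh e
  ... | _ , ()

  run-from-target : (t : Term V) {𝔄 : Structure V} → ∀ {x y} →
                    Run (aut t) 𝔄 (tgt (aut t)) x (tgt (aut t)) y → x ≡ y
  run-from-target t = run-from-sink (target-is-sink t)

  loops-avoid-target : (t : Term V) → LoopsAvoidTarget (aut t)
  loops-avoid-target (var a) (_ , _ , _ , here ())
  loops-avoid-target (var a) (_ , _ , _ , there ())
  loops-avoid-target 𝟘       (_ , _ , _ , ())
  loops-avoid-target 𝟙       (_ , _ , _ , here ())
  loops-avoid-target 𝟙       (_ , _ , _ , there ())
  loops-avoid-target (t ⊕ u) (_ , _ , _ , here ())
  loops-avoid-target (t ⊕ u) (_ , _ , _ , there (here ()))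
  loops-avoid-target (t ⊕ u) (_ , _ , _ , there (there (here ())))
  loops-avoid-target (t ⊕ u) (_ , _ , _ , there (there (there (here ()))))
  loops-avoid-target (t ⊕ u) (_ , _ , _ , there (there (there (there e))))
    with ∈-++⁻ (mapTrans (Component.ι (⊕-left t u)) (trans (aut t))) e
  ... | inj₁ e₁ with mapTrans-loop-source _ e₁
  ...   | _ , refl , src =
          component-loops-avoid-target (⊕-left t u) (loops-avoid-target t) (λ ()) src
  loops-avoid-target (t ⊕ u) (_ , _ , _ , there (there (there (there e)))) | inj₂ e₂
    with mapTrans-loop-source _ e₂
  ...   | _ , refl , src =
          component-loops-avoid-target (⊕-right t u) (loops-avoid-target u) (λ ()) src
  loops-avoid-target (t ⨾ u) (_ , _ , _ , here ())
  loops-avoid-target (t ⨾ u) (_ , _ , _ , there e)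
    with ∈-++⁻ (mapTrans (Component.ι (⨾-left t u)) (trans (aut t))) e
  ... | inj₁ e₁ with mapTrans-loop-source _ e₁
  ...   | _ , refl , src =
          component-loops-avoid-target (⨾-left t u) (loops-avoid-target t)
            (λ eq → ⊥-elim (⨾-left≢right t u (sym eq))) src
  loops-avoid-target (t ⨾ u) (_ , _ , _ , there e) | inj₂ e₂ with mapTrans-loop-source _ e₂
  ...   | _ , refl , src =
          component-loops-avoid-target (⨾-right t u) (loops-avoid-target u)
            (λ eq → sym (Component.ι-injective (⨾-right t u) eq)) src
  loops-avoid-target (t ⋆) (_ , _ , _ , here ())
  loops-avoid-target (t ⋆) (_ , _ , _ , there (here ()))
  loops-avoid-target (t ⋆) (_ , _ , _ , there (there (here ())))
  loops-avoid-target (t ⋆) (_ , _ , _ , there (there (there (here ()))))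
  loops-avoid-target (t ⋆) (_ , _ , _ , there (there (there (there e))))
    with mapTrans-loop-source sh e
  ... | _ , refl , src =
        component-loops-avoid-target (⋆-body t) (loops-avoid-target t) (λ ()) src
  loops-avoid-target (t ↺) (_ , _ , _ , here refl) ρ
    with restrict (↺-body t) (loops-avoid-target t) ρ
  ... | inside () _
  ... | exits _ () _ _
  loops-avoid-target (t ↺) (_ , _ , _ , there e) with mapTrans-loop-source sh e
  ... | _ , refl , src =
        component-loops-avoid-target (↺-body t) (loops-avoid-target t) (λ ()) src

  module _ (𝔄 : Structure V) where

    recognizes-denotation : (t : Term V) → ⟦ t ⟧ 𝔄 ⇒ Recognized (aut t) 𝔄
    recognizes-denotation (var a) h = stepV (here refl) h done
    recognizes-denotation 𝟘 ()
    recognizes-denotation 𝟙 refl = stepI (here refl) done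
    recognizes-denotation (t ⊕ u) (inj₁ h) =
      stepI (here refl)
        (embed (⊕-left t u) (recognizes-denotation t h) ++ᴿ stepI (there (there (here refl))) done)
    recognizes-denotation (t ⊕ u) (inj₂ h) =
      stepI (there (here refl))
        (embed (⊕-right t u) (recognizes-denotation u h) ++ᴿ stepI (there (there (there (here refl)))) done)
    recognizes-denotation (t ⨾ u) (_ , h₁ , h₂) =
      embed (⨾-left t u) (recognizes-denotation t h₁)
        ++ᴿ stepI (here refl) (embed (⨾-right t u) (recognizes-denotation u h₂))
    recognizes-denotation (t ⋆) ε        = stepI (there (here refl)) done
    recognizes-denotation (t ⋆) (h ◅ hs) = stepI (here refl) (iterations h hs)
      where
      iterations : ∀ {x y z} → ⟦ t ⟧ 𝔄 x y → Star (⟦ t ⟧ 𝔄) y z →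
                   Run (aut (t ⋆)) 𝔄 (sh (src (aut t))) x s₁ z
      iterations h ε =
        embed (⋆-body t) (recognizes-denotation t h) ++ᴿ stepI (there (there (there (here refl)))) done
      iterations h (h′ ◅ hs) =
        embed (⋆-body t) (recognizes-denotation t h) ++ᴿ stepI (there (there (here refl))) (iterations h′ hs)
    recognizes-denotation (t ↺) (h , refl) =
      stepL (here refl) (embed (↺-body t) (recognizes-denotation t h)) done

    iterations-from-body : (t : Term V) {S : D 𝔄 → D 𝔄 → Set} → Recognized (aut t) 𝔄 ⇒ S →
                           ∀ {x y} (ρ : Run (aut (t ⋆)) 𝔄 (sh (src (aut t))) x s₁ y) →
                           Acc _<_ (length ρ) → Star S x y
    iterations-from-body t body ρ (acc shorter-accessible)
      with restrict (⋆-body t) (loops-avoid-target t) ρ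
    ... | inside () _
    ... | exits ρ′ (inj₁ refl) rest shorter =
          body ρ′ ◅ iterations-from-body t body rest (shorter-accessible shorter)
    ... | exits ρ′ (inj₂ refl) rest _ with run-from-target (t ⋆) rest
    ...   | refl = body ρ′ ◅ ε

    denotes-recognized : (t : Term V) → Recognized (aut t) 𝔄 ⇒ ⟦ t ⟧ 𝔄
    denotes-recognized (var a) (stepV (here refl) h ρ) with run-from-target (var a) ρ
    ... | refl = h
    denotes-recognized (var a) (stepV (there ()) _ _)
    denotes-recognized (var a) (stepI (here ()) _)
    denotes-recognized (var a) (stepI (there ()) _)
    denotes-recognized (var a) (stepL (here ()) _ _)
    denotes-recognized (var a) (stepL (there ()) _ _)
    denotes-recognized 𝟘 (stepV () _ _)
    denotes-recognized 𝟘 (stepI () _)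
    denotes-recognized 𝟘 (stepL () _ _)
    denotes-recognized 𝟙 (stepI (here refl) ρ) = run-from-target 𝟙 ρ
    denotes-recognized 𝟙 (stepI (there ()) _)
    denotes-recognized 𝟙 (stepV (here ()) _ _)
    denotes-recognized 𝟙 (stepV (there ()) _ _)
    denotes-recognized 𝟙 (stepL (here ()) _ _)
    denotes-recognized 𝟙 (stepL (there ()) _ _)
    denotes-recognized (t ⊕ u) ρ with first-ε-step (⊕-initial t u) (λ ()) ρ
    ... | _ , inj₁ refl , ρ′ with restrict (⊕-left t u) (loops-avoid-target t) ρ′
    ...   | inside () _
    ...   | exits ρt refl rest _ with run-from-target (t ⊕ u) rest
    ...     | refl = inj₁ (denotes-recognized t ρt)
    denotes-recognized (t ⊕ u) ρ | _ , inj₂ refl , ρ′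
      with restrict (⊕-right t u) (loops-avoid-target u) ρ′
    ...   | inside () _
    ...   | exits ρu refl rest _ with run-from-target (t ⊕ u) rest
    ...     | refl = inj₂ (denotes-recognized u ρu)
    denotes-recognized (t ⨾ u) ρ with restrict (⨾-left t u) (loops-avoid-target t) ρ
    ... | inside eq _ = ⊥-elim (⨾-left≢right t u (sym eq))
    ... | exits ρt refl rest _ with restrict (⨾-right t u) (loops-avoid-target u) rest
    ...   | exits _ () _ _
    ...   | inside eq ρu with Component.ι-injective (⨾-right t u) eq
    ...     | refl = _ , denotes-recognized t ρt , denotes-recognized u ρu
    denotes-recognized (t ⋆) ρ with first-ε-step (⋆-initial t) (λ ()) ρ
    ... | _ , inj₁ refl , ρ′ = iterations-from-body t (denotes-recognized t) ρ′ (<-wellFounded _)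
    ... | _ , inj₂ refl , ρ′ with run-from-target (t ⋆) ρ′
    ...   | refl = ε
    denotes-recognized (t ↺) (stepV e _ _) with ↺-initial t e
    ... | () , _
    denotes-recognized (t ↺) (stepI e _) with ↺-initial t e
    ... | () , _
    denotes-recognized (t ↺) (stepL e σ ρ) with ↺-initial t e
    ... | refl , refl with run-from-target (t ↺) ρ | restrict (↺-body t) (loops-avoid-target t) σ
    ...   | refl | exits _ () _ _
    ...   | refl | inside eq σt with sh-injective eq
    ...     | refl = denotes-recognized t σt , refl

lemma13 : {V : Set} (t : Term V) (𝔄 : Structure V) →
          ⟦ t ⟧ 𝔄 ⇔ Recognized (aut t) 𝔄
lemma13 t 𝔄 = recognizes-denotation 𝔄 t , denotes-recognized 𝔄 t
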